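{- Let $\mathcal{S}$, $\mathcal{M}_2$, $\mathcal{MM}_2$ and the maps $\phi:\mathcal{S}\to\mathcal{MM}_2$ and $\psi:\mathcal{M}_2\to\mathcal{MM}_2$ be as described in the context. Then $\phi(\mathcal{S})=\psi(\mathcal{M}_2)$.
   Context: A quarter plane walk is a finite walk in $\mathbb{Z}^2$ starting at $(0,0)$, staying in $\{(i,j): i\ge 0, j\ge 0\}$, using steps from a given set; its length is its number of steps. $\mathcal{S}$ is the class of quarter plane walks with steps from $\{(1,0),(1,-1),(0,-1),(-1,0),(-1,1),(0,1)\}$, written $\rightarrow,\searrow,\downarrow,\leftarrow,\nwarrow,\uparrow$ respectively. A Motzkin path is a walk from $(0,0)$ using the steps $\nearrow=(1,1)$, $\rightarrow=(1,0)$, $\searrow=(1,-1)$, never going below the $x$-axis and ending on the $x$-axis. $\mathcal{M}_2$ is the class of bicoloured Motzkin paths (each step coloured red or black); $\mathcal{MM}_2$ is the class of bicoloured Motzkin paths in which each step is additionally either marked or unmarked. The map $\phi$: given $w\in\mathcal{S}$, start with the empty path $m$ and read the steps of $w$ from first to last, modifying $m$ as follows. (1) Step $\uparrow$: append a marked red $\rightarrow$ to $m$. (2) Step $\rightarrow$: append a marked black $\rightarrow$ to $m$. (3) Step $\searrow$: find the rightmost step of $m$ that is either a marked red $\rightarrow$ or a marked black $\searrow$; if it is a marked red $\rightarrow$ replace it by an unmarked red $\nearrow$, if it is a marked black $\searrow$ replace it by an unmarked black $\rightarrow$. Then append a marked red $\searrow$. (4) Step $\nwarrow$: find the rightmost step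 of $m$ that is either a marked black $\rightarrow$ or a marked red $\searrow$; if it is a marked black $\rightarrow$ replace it by an unmarked black $\nearrow$, if it is a marked red $\searrow$ replace it by an unmarked red $\rightarrow$. Then append a marked black $\searrow$. (5) Step $\leftarrow$: perform the same search and replacement as in (4), then append an unmarked red $\searrow$. (6) Step $\downarrow$: perform the same search and replacement as in (3), then append an unmarked black $\searrow$. The final $m$ is $\phi(w)$. The map $\psi$: given $s\in\mathcal{M}_2$, initially no step has a marking status; call a step "free" if it has not yet been set to marked or unmarked. Read the steps of $s$ from left to right; for the current step: (1) If it is a $\nearrow$ (either colour): do nothing. (2) If it is a red $\rightarrow$: find the rightmost free step before the current step which is a red $\nearrow$ or a black $\rightarrow$. If it exists, set it to unmarked and leave the current step free; otherwise set the current step to marked. (3) If it is a black $\rightarrow$: find the rightmost free step before the current step which is a black $\nearrow$ or a red $\rightarrow$. If it exists, set it to unmarked and leave the current step free; otherwise set the current step to marked. (4) If it is a red $\searrow$: find the rightmost free step before the current step which is a black $\nearrow$ or a red $\rightarrow$. If it exists, set both it and the current step to unmarked. Otherwise find the rightmost free step before the current step which is a red $\nearrow$ or a black $\rightarrow$, set it to unmarked and set the current step to marked. (5) If it is a black $\searrow$: find the rightmost free step before the current step which is a red $\nearrow$ or a black $\rightarrow$. If it exists, set both it and the current step to unmarked. Otherwise find the rightmost free step before the current step which is a black $\nearrow$ or a red $\rightarrow$, set it to unmarked and set the current step to marked. The result, with the same underlying bicoloured path and the assigned markings, is $\psi(s)$. (Both $\phi$ and $\psi$ are known to be well defined with values in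 $\mathcal{MM}_2$.) -}

module Defs where

open import Data.Nat using (ℕ; zero; suc)
open import Data.Bool using (Bool; true; false; if_then_else_)
open import Data.Maybe using (Maybe; just; nothing; _>>=_)
open import Data.List using (List; []; _∷_; _++_; [_]; map)
open import Data.Product using (_×_; _,_; proj₁)

data Step : Set where
  E SE S W NW N : Step

-- QPFrom i j ws : the walk ws started at (i , j) stays in the quarter plane.
data QPFrom : ℕ → ℕ → List Step → Set where
  done   : ∀ {i j} → QPFrom i j []
  stepE  : ∀ {i j ws} → QPFrom (suc i) j ws → QPFrom i j (E ∷ ws)
  stepSE : ∀ {i j ws} → QPFrom (suc i) j ws → QPFrom i (suc j) (SE ∷ ws)
  stepS  : ∀ {i j ws} → QPFrom i j ws → QPFrom i (suc j) (S ∷ ws)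
  stepW  : ∀ {i j ws} → QPFrom i j ws → QPFrom (suc i) j (W ∷ ws)
  stepNW : ∀ {i j ws} → QPFrom i (suc j) ws → QPFrom (suc i) j (NW ∷ ws)
  stepN  : ∀ {i j ws} → QPFrom i (suc j) ws → QPFrom i j (N ∷ ws)

InS : List Step → Set
InS w = QPFrom 0 0 w

data Dir : Set where
  up flat down : Dir

data Colour : Set where
  red black : Colour

-- MotzFrom h ds : starting at height h, never below the axis, ends on the axis
data MotzFrom : ℕ → List Dir → Set where
  end   : MotzFrom 0 []
  stUp   : ∀ {h ds} → MotzFrom (suc h) ds → MotzFrom h (up ∷ ds)
  stFlat : ∀ {h ds} → MotzFrom h ds → MotzFrom h (flat ∷ ds)
  stDown : ∀ {h ds} → MotzFrom h ds → MotzFrom (suc h) (down ∷ ds)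

CStep : Set
CStep = Dir × Colour

InM2 : List CStep → Set
InM2 s = MotzFrom 0 (map proj₁ s)

-- a step of a marked bicoloured path; the Bool is true iff marked
MStep : Set
MStep = Dir × Colour × Bool

InMM2 : List MStep → Set
InMM2 m = MotzFrom 0 (map proj₁ m)

replaceLast : {A : Set} → (A → Maybe A) → List A → Maybe (List A)
replaceLast f [] = nothing
replaceLast f (x ∷ xs) with replaceLast f xs
... | just ys = just (x ∷ ys)
... | nothing with f x
...   | just y  = just (y ∷ xs)
...   | nothing = nothing

r3 : MStep → Maybe MStep
r3 (flat , red , true)   = just (up , red , false)
r3 (down , black , true) = just (flat , black , false)
r3 _ = nothing

r4 : MStep → Maybe MStep
r4 (flat , black , true) = just (up , black , false)
r4 (down , red , true)   = just (flat , red , false)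
r4 _ = nothing

phiStep : Step → List MStep → Maybe (List MStep)
phiStep N  m = just (m ++ [ (flat , red , true) ])
phiStep E  m = just (m ++ [ (flat , black , true) ])
phiStep SE m = replaceLast r3 m >>= λ m' → just (m' ++ [ (down , red , true) ])
phiStep NW m = replaceLast r4 m >>= λ m' → just (m' ++ [ (down , black , true) ])
phiStep W  m = replaceLast r4 m >>= λ m' → just (m' ++ [ (down , red , false) ])
phiStep S  m = replaceLast r3 m >>= λ m' → just (m' ++ [ (down , black , false) ])

phiFrom : List MStep → List Step → Maybe (List MStep)
phiFrom m [] = just m
phiFrom m (x ∷ ws) = phiStep x m >>= λ m' → phiFrom m' ws

φ : List Step → Maybe (List MStep)
φ w = phiFrom [] w

-- status: nothing = free, just true = marked, just false = unmarked
PStep : Set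
PStep = Dir × Colour × Maybe Bool

isA : CStep → Bool
isA (up , red)     = true
isA (flat , black) = true
isA _ = false

isB : CStep → Bool
isB (up , black) = true
isB (flat , red) = true
isB _ = false

setFree : (CStep → Bool) → PStep → Maybe PStep
setFree p (d , c , nothing) = if p (d , c) then just (d , c , just false) else nothing
setFree p (d , c , just _)  = nothing

psiFlat : (CStep → Bool) → Colour → List PStep → Maybe (List PStep)
psiFlat p c ps with replaceLast (setFree p) ps
... | just ps' = just (ps' ++ [ (flat , c , nothing) ])
... | nothing  = just (ps ++ [ (flat , c , just true) ])

psiDown : (CStep → Bool) → (CStep → Bool) → Colour → List PStep → Maybe (List PStep)
psiDown p q c ps with replaceLast (setFree p) ps
... | just ps' = just (ps' ++ [ (down , c , just false) ])
... | nothing with replaceLast (setFree q) ps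
...   | just ps' = just (ps' ++ [ (down , c , just true) ])
...   | nothing  = nothing

psiStep : CStep → List PStep → Maybe (List PStep)
psiStep (up , c)       ps = just (ps ++ [ (up , c , nothing) ])
psiStep (flat , red)   ps = psiFlat isA red ps
psiStep (flat , black) ps = psiFlat isB black ps
psiStep (down , red)   ps = psiDown isB isA red ps
psiStep (down , black) ps = psiDown isA isB black ps

psiFrom : List PStep → List CStep → Maybe (List PStep)
psiFrom ps [] = just ps
psiFrom ps (x ∷ s) = psiStep x ps >>= λ ps' → psiFrom ps' s

finalize : List PStep → Maybe (List MStep)
finalize [] = just []
finalize ((d , c , just b) ∷ ps) = finalize ps >>= λ ms → just ((d , c , b) ∷ ms)
finalize ((d , c , nothing) ∷ ps) = nothing

ψ : List CStep → Maybe (List MStep)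
ψ s = psiFrom [] s >>= finalize

module Submission where

-- Both maps build the same marked path one step at a time, and a marked path m names its preimages:
-- the walk decode m, reading each step as the step of the walk that made φ append it, and the
-- bicoloured path forget m. To compare the two constructions, annotate every step of the path under
-- construction as settled, or open: still free in ψ, and still a marked → or ↘ that rule (3) or (4)
-- of φ may rewrite later. The states of ψ and of φ are then two views of one annotated list, and the
-- search of ψ for a free step of a class and the search of φ for a marked step of that class select
-- the same item, because the settled marked steps that only φ sees never lie after an open step of
-- their class. Running this simulation forwards along ψ shows that ψ-images are φ-images; as the fate
-- of a marked step of φ is known only at the end, the converse runs backwards along φ. The side
-- conditions come for free: φ succeeds only on quarter-plane walks, the coordinates counting per class
-- the marked steps φ may still rewrite, and ψ only on Motzkin paths, the height being the number of
-- free steps.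

open import Defs
open import Data.List using (List)
open import Data.Maybe using (just)
open import Data.Product using (_×_; ∃-syntax)
open import Function.Bundles using (_⇔_)
open import Relation.Binary.PropositionalEquality using (_≡_)

open import Data.Bool using (Bool; true; false; if_then_else_)
open import Data.Empty using (⊥-elim)
open import Data.List using ([]; _∷_; _++_; [_]; _∷ʳ_; map)
open import Data.List.Properties using (map-++; map-∘; map-id; ++-identityʳ; ∷ʳ-++; ∷-injective)
open import Data.List.Relation.Unary.All using (All; []; _∷_)
import Data.List.Relation.Unary.All as All
import Data.List.Relation.Unary.All.Properties as All
open import Data.List.Relation.Unary.All.Properties using (∷ʳ⁺; ∷ʳ⁻)
open import Data.Maybe using (Maybe; nothing; is-just; is-nothing; _>>=_) renaming (map to mapMaybe)
open import Data.Nat using (ℕ; suc)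
open import Data.Product using (_,_; proj₁; proj₂; map₂)
open import Data.Sum using (_⊎_; inj₁; inj₂)
import Data.Sum as Sum
open import Data.Unit using (⊤; tt)
open import Function.Bundles using (mk⇔)
open import Relation.Binary.PropositionalEquality using (_≢_; refl; sym; trans; cong; subst; subst₂)

module _ {A : Set} (g : A → Maybe A) where

  data LastReplaced : List A → List A → Set where
    here  : ∀ {x y xs} → g x ≡ just y → All (λ z → g z ≡ nothing) xs →
            LastReplaced (x ∷ xs) (y ∷ xs)
    there : ∀ {x xs ys} → LastReplaced xs ys → LastReplaced (x ∷ xs) (x ∷ ys)

  replaceLast-nothing⁻ : ∀ xs → replaceLast g xs ≡ nothing → All (λ x → g x ≡ nothing) xs
  replaceLast-nothing⁻ [] _ = []
  replaceLast-nothing⁻ (x ∷ xs) eq with replaceLast g xs in found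
  replaceLast-nothing⁻ (x ∷ xs) () | just _
  ... | nothing with g x in gx
  replaceLast-nothing⁻ (x ∷ xs) () | nothing | just _
  ... | nothing = gx ∷ replaceLast-nothing⁻ xs found

  replaceLast-just⁻ : ∀ xs {ys} → replaceLast g xs ≡ just ys → LastReplaced xs ys
  replaceLast-just⁻ (x ∷ xs) eq with replaceLast g xs in found
  replaceLast-just⁻ (x ∷ xs) refl | just ys = there (replaceLast-just⁻ xs found)
  ... | nothing with g x in gx
  replaceLast-just⁻ (x ∷ xs) refl | nothing | just y = here gx (replaceLast-nothing⁻ xs found)
  replaceLast-just⁻ (x ∷ xs) () | nothing | nothing

  replaceLast-nothing⁺ : ∀ {xs} → All (λ x → g x ≡ nothing) xs → replaceLast g xs ≡ nothing
  replaceLast-nothing⁺ [] = refl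
  replaceLast-nothing⁺ {x ∷ xs} (gx ∷ none) rewrite replaceLast-nothing⁺ none | gx = refl

  replaceLast-just⁺ : ∀ {xs ys} → LastReplaced xs ys → replaceLast g xs ≡ just ys
  replaceLast-just⁺ (here gx none) rewrite replaceLast-nothing⁺ none | gx = refl
  replaceLast-just⁺ (there r) rewrite replaceLast-just⁺ r = refl

module _ {A : Set} {g : A → Maybe A} where

  LastReplaced-All⁺ : ∀ {P : A → Set} → (∀ {x y} → g x ≡ just y → P y) →
    ∀ {xs ys} → LastReplaced g xs ys → All P xs → All P ys
  LastReplaced-All⁺ resolved (here gx _) (_ ∷ pxs) = resolved gx ∷ pxs
  LastReplaced-All⁺ resolved (there r) (px ∷ pxs) = px ∷ LastReplaced-All⁺ resolved r pxs

  LastReplaced-All⁻ : ∀ {P : A → Set} → (∀ {x y} → g x ≡ just y → P x) →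
    ∀ {xs ys} → LastReplaced g xs ys → All P ys → All P xs
  LastReplaced-All⁻ replaced (here gx _) (_ ∷ pys) = replaced gx ∷ pys
  LastReplaced-All⁻ replaced (there r) (py ∷ pys) = py ∷ LastReplaced-All⁻ replaced r pys

  LastReplaced-map-≡ : ∀ {B : Set} (h : A → B) → (∀ {x y} → g x ≡ just y → h x ≡ h y) →
    ∀ {xs ys} → LastReplaced g xs ys → map h xs ≡ map h ys
  LastReplaced-map-≡ h invariant (here {xs = xs} gx _) = cong (_∷ map h xs) (invariant gx)
  LastReplaced-map-≡ h invariant (there r) = cong (_ ∷_) (LastReplaced-map-≡ h invariant r)

module _ {A B : Set} {f : B → Maybe B} {g : A → Maybe A} {h : A → B}
         (square : ∀ a → f (h a) ≡ mapMaybe h (g a)) where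

  nothing-square⁺ : ∀ a → g a ≡ nothing → f (h a) ≡ nothing
  nothing-square⁺ a ga = trans (square a) (cong (mapMaybe h) ga)

  nothing-square⁻ : ∀ a → f (h a) ≡ nothing → g a ≡ nothing
  nothing-square⁻ a fha with g a | trans (sym fha) (square a)
  ... | nothing | _ = refl

  LastReplaced-map⁺ : ∀ {xs ys} → LastReplaced g xs ys → LastReplaced f (map h xs) (map h ys)
  LastReplaced-map⁺ (here {x} gx none) =
    here (trans (square x) (cong (mapMaybe h) gx)) (All.map⁺ (All.map (nothing-square⁺ _) none))
  LastReplaced-map⁺ (there r) = there (LastReplaced-map⁺ r)

  LastReplaced-map⁻ : ∀ xs {zs} → LastReplaced f (map h xs) zs →
    ∃[ ys ] LastReplaced g xs ys × zs ≡ map h ys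
  LastReplaced-map⁻ (x ∷ xs) (here fhx none) with g x in gx | trans (sym fhx) (square x)
  ... | just y | refl = y ∷ xs , here gx (All.map (nothing-square⁻ _) (All.map⁻ none)) , refl
  LastReplaced-map⁻ (x ∷ xs) (there r) with LastReplaced-map⁻ xs r
  ... | ys , r′ , refl = x ∷ ys , there r′ , refl

map-∷ʳ⁻ : ∀ {A B : Set} (h : A → B) xs {ys y} → map h xs ≡ ys ∷ʳ y →
  ∃[ xs′ ] ∃[ x ] xs ≡ xs′ ∷ʳ x × map h xs′ ≡ ys × h x ≡ y
map-∷ʳ⁻ h (x ∷ []) {[]} refl = [] , x , refl , refl , refl
map-∷ʳ⁻ h (x ∷ _ ∷ _) {[]} ()
map-∷ʳ⁻ h (x ∷ xs) {_ ∷ ys} eq with ∷-injective eq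
... | refl , eq′ with map-∷ʳ⁻ h xs eq′
...   | xs′ , x′ , refl , refl , refl = x ∷ xs′ , x′ , refl , refl , refl

count : {A : Set} → (A → Bool) → List A → ℕ
count p [] = 0
count p (x ∷ xs) = if p x then suc (count p xs) else count p xs

module _ {A : Set} (p : A → Bool) where

  count-∷ʳ-accept : ∀ xs {x} → p x ≡ true → count p (xs ∷ʳ x) ≡ suc (count p xs)
  count-∷ʳ-accept [] px rewrite px = refl
  count-∷ʳ-accept (y ∷ xs) px with p y
  ... | true = cong suc (count-∷ʳ-accept xs px)
  ... | false = count-∷ʳ-accept xs px

  count-∷ʳ-reject : ∀ xs {x} → p x ≡ false → count p (xs ∷ʳ x) ≡ count p xs
  count-∷ʳ-reject [] px rewrite px = refl
  count-∷ʳ-reject (y ∷ xs) px with p y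
  ... | true = cong suc (count-∷ʳ-reject xs px)
  ... | false = count-∷ʳ-reject xs px

  module _ {g : A → Maybe A} where

    count-LastReplaced-≡ : (∀ {x y} → g x ≡ just y → p x ≡ p y) →
      ∀ {xs ys} → LastReplaced g xs ys → count p xs ≡ count p ys
    count-LastReplaced-≡ invariant (here {xs = xs} gx _) =
      cong (λ b → if b then suc (count p xs) else count p xs) (invariant gx)
    count-LastReplaced-≡ invariant (there {x} r) with p x
    ... | true = cong suc (count-LastReplaced-≡ invariant r)
    ... | false = count-LastReplaced-≡ invariant r

    count-LastReplaced-suc : (∀ {x y} → g x ≡ just y → p x ≡ true × p y ≡ false) →
      ∀ {xs ys} → LastReplaced g xs ys → count p xs ≡ suc (count p ys)
    count-LastReplaced-suc removed (here gx _) rewrite proj₁ (removed gx) | proj₂ (removed gx) = refl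
    count-LastReplaced-suc removed (there {x} r) with p x
    ... | true = cong suc (count-LastReplaced-suc removed r)
    ... | false = count-LastReplaced-suc removed r

other : Colour → Colour
other red = black
other black = red

onBoth : ∀ {P : Colour → Set} c → P c → P (other c) → ∀ c′ → P c′
onBoth red p q red = p
onBoth red p q black = q
onBoth black p q red = q
onBoth black p q black = p

flatStep markedDownStep unmarkedDownStep : Colour → Step
flatStep red = N
flatStep black = E
markedDownStep red = SE
markedDownStep black = NW
unmarkedDownStep red = W
unmarkedDownStep black = S

-- Class red is {red ↗, black →} and class black is {black ↗, red →}; rule c is the search of φ for
-- the marked steps that end up in class c.
rule : Colour → MStep → Maybe MStep
rule red = r3
rule black = r4

data PhiStep (m : List MStep) : Step → List MStep → Set where
  appendFlat : ∀ c → PhiStep m (flatStep c) (m ∷ʳ (flat , c , true))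
  appendMarkedDown : ∀ c {m′} → LastReplaced (rule c) m m′ →
    PhiStep m (markedDownStep c) (m′ ∷ʳ (down , c , true))
  appendUnmarkedDown : ∀ c {m′} → LastReplaced (rule (other c)) m m′ →
    PhiStep m (unmarkedDownStep c) (m′ ∷ʳ (down , c , false))

phiStep-graph⁺ : ∀ {x m m′} → PhiStep m x m′ → phiStep x m ≡ just m′
phiStep-graph⁺ (appendFlat red) = refl
phiStep-graph⁺ (appendFlat black) = refl
phiStep-graph⁺ (appendMarkedDown red r) rewrite replaceLast-just⁺ r3 r = refl
phiStep-graph⁺ (appendMarkedDown black r) rewrite replaceLast-just⁺ r4 r = refl
phiStep-graph⁺ (appendUnmarkedDown red r) rewrite replaceLast-just⁺ r4 r = refl
phiStep-graph⁺ (appendUnmarkedDown black r) rewrite replaceLast-just⁺ r3 r = refl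

module _ (m : List MStep) where

  private
    marked-down⁻ : ∀ c {m′} →
      (replaceLast (rule c) m >>= λ m″ → just (m″ ∷ʳ (down , c , true))) ≡ just m′ →
      PhiStep m (markedDownStep c) m′
    marked-down⁻ c eq with replaceLast (rule c) m in found
    marked-down⁻ c refl | just _ = appendMarkedDown c (replaceLast-just⁻ (rule c) m found)

    unmarked-down⁻ : ∀ c {m′} →
      (replaceLast (rule (other c)) m >>= λ m″ → just (m″ ∷ʳ (down , c , false))) ≡ just m′ →
      PhiStep m (unmarkedDownStep c) m′
    unmarked-down⁻ c eq with replaceLast (rule (other c)) m in found
    unmarked-down⁻ c refl | just _ = appendUnmarkedDown c (replaceLast-just⁻ (rule (other c)) m found)

  phiStep-graph⁻ : ∀ x {m′} → phiStep x m ≡ just m′ → PhiStep m x m′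
  phiStep-graph⁻ N refl = appendFlat red
  phiStep-graph⁻ E refl = appendFlat black
  phiStep-graph⁻ SE = marked-down⁻ red
  phiStep-graph⁻ NW = marked-down⁻ black
  phiStep-graph⁻ W = unmarked-down⁻ red
  phiStep-graph⁻ S = unmarked-down⁻ black

class : Colour → CStep → Bool
class red = isA
class black = isB

unmarkFree : Colour → PStep → Maybe PStep
unmarkFree c = setFree (class c)

data PsiStep (ps : List PStep) : CStep → List PStep → Set where
  appendUp : ∀ c → PsiStep ps (up , c) (ps ∷ʳ (up , c , nothing))
  pairFlat : ∀ c {ps′} → LastReplaced (unmarkFree c) ps ps′ →
    PsiStep ps (flat , c) (ps′ ∷ʳ (flat , c , nothing))
  markFlat : ∀ c → All (λ p → unmarkFree c p ≡ nothing) ps →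
    PsiStep ps (flat , c) (ps ∷ʳ (flat , c , just true))
  pairDown : ∀ c {ps′} → LastReplaced (unmarkFree (other c)) ps ps′ →
    PsiStep ps (down , c) (ps′ ∷ʳ (down , c , just false))
  markDown : ∀ c {ps′} → All (λ p → unmarkFree (other c) p ≡ nothing) ps →
    LastReplaced (unmarkFree c) ps ps′ → PsiStep ps (down , c) (ps′ ∷ʳ (down , c , just true))

module _ {ps : List PStep} where

  private
    psiFlat-graph⁺ : ∀ c {ps′} → PsiStep ps (flat , c) ps′ → psiFlat (class c) c ps ≡ just ps′
    psiFlat-graph⁺ c (pairFlat c r) rewrite replaceLast-just⁺ (unmarkFree c) r = refl
    psiFlat-graph⁺ c (markFlat c none) rewrite replaceLast-nothing⁺ (unmarkFree c) none = refl

    psiDown-graph⁺ : ∀ c {ps′} → PsiStep ps (down , c) ps′ →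
      psiDown (class (other c)) (class c) c ps ≡ just ps′
    psiDown-graph⁺ c (pairDown c r) rewrite replaceLast-just⁺ (unmarkFree (other c)) r = refl
    psiDown-graph⁺ c (markDown c none r)
      rewrite replaceLast-nothing⁺ (unmarkFree (other c)) none | replaceLast-just⁺ (unmarkFree c) r = refl

  psiStep-graph⁺ : ∀ {x ps′} → PsiStep ps x ps′ → psiStep x ps ≡ just ps′
  psiStep-graph⁺ (appendUp c) = refl
  psiStep-graph⁺ s@(pairFlat red _) = psiFlat-graph⁺ red s
  psiStep-graph⁺ s@(pairFlat black _) = psiFlat-graph⁺ black s
  psiStep-graph⁺ s@(markFlat red _) = psiFlat-graph⁺ red s
  psiStep-graph⁺ s@(markFlat black _) = psiFlat-graph⁺ black s
  psiStep-graph⁺ s@(pairDown red _) = psiDown-graph⁺ red s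
  psiStep-graph⁺ s@(pairDown black _) = psiDown-graph⁺ black s
  psiStep-graph⁺ s@(markDown red _ _) = psiDown-graph⁺ red s
  psiStep-graph⁺ s@(markDown black _ _) = psiDown-graph⁺ black s

module _ (ps : List PStep) where

  private
    psiFlat-graph⁻ : ∀ c {ps′} → psiFlat (class c) c ps ≡ just ps′ → PsiStep ps (flat , c) ps′
    psiFlat-graph⁻ c eq with replaceLast (unmarkFree c) ps in found
    psiFlat-graph⁻ c refl | just _ = pairFlat c (replaceLast-just⁻ (unmarkFree c) ps found)
    psiFlat-graph⁻ c refl | nothing = markFlat c (replaceLast-nothing⁻ (unmarkFree c) ps found)

    psiDown-graph⁻ : ∀ c {ps′} → psiDown (class (other c)) (class c) c ps ≡ just ps′ →
      PsiStep ps (down , c) ps′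
    psiDown-graph⁻ c eq with replaceLast (unmarkFree (other c)) ps in found
    psiDown-graph⁻ c refl | just _ = pairDown c (replaceLast-just⁻ (unmarkFree (other c)) ps found)
    ... | nothing with replaceLast (unmarkFree c) ps in found′
    psiDown-graph⁻ c refl | nothing | just _ =
      markDown c (replaceLast-nothing⁻ (unmarkFree (other c)) ps found)
                 (replaceLast-just⁻ (unmarkFree c) ps found′)

  psiStep-graph⁻ : ∀ x {ps′} → psiStep x ps ≡ just ps′ → PsiStep ps x ps′
  psiStep-graph⁻ (up , c) refl = appendUp c
  psiStep-graph⁻ (flat , red) = psiFlat-graph⁻ red
  psiStep-graph⁻ (flat , black) = psiFlat-graph⁻ black
  psiStep-graph⁻ (down , red) = psiDown-graph⁻ red
  psiStep-graph⁻ (down , black) = psiDown-graph⁻ black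

-- φ accepts only quarter-plane walks

data Fires : Colour → MStep → MStep → Set where
  firesFlat : ∀ c → Fires c (flat , c , true) (up , c , false)
  firesDown : ∀ c → Fires c (down , other c , true) (flat , other c , false)

rule-Fires : ∀ c x {y} → rule c x ≡ just y → Fires c x y
rule-Fires red (flat , red , true) refl = firesFlat red
rule-Fires red (down , black , true) refl = firesDown red
rule-Fires black (flat , black , true) refl = firesFlat black
rule-Fires black (down , red , true) refl = firesDown black
rule-Fires red (up , _ , _) ()
rule-Fires red (flat , red , false) ()
rule-Fires red (flat , black , _) ()
rule-Fires red (down , red , _) ()
rule-Fires red (down , black , false) ()
rule-Fires black (up , _ , _) ()
rule-Fires black (flat , black , false) ()
rule-Fires black (flat , red , _) ()
rule-Fires black (down , black , _) ()
rule-Fires black (down , red , false) ()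

φ-candidate : Colour → MStep → Bool
φ-candidate c x = is-just (rule c x)

Fires-removes : ∀ {c x y} → Fires c x y → φ-candidate c x ≡ true × φ-candidate c y ≡ false
Fires-removes (firesFlat red) = refl , refl
Fires-removes (firesFlat black) = refl , refl
Fires-removes (firesDown red) = refl , refl
Fires-removes (firesDown black) = refl , refl

Fires-keeps : ∀ {c x y} → Fires c x y → φ-candidate (other c) x ≡ φ-candidate (other c) y
Fires-keeps (firesFlat red) = refl
Fires-keeps (firesFlat black) = refl
Fires-keeps (firesDown red) = refl
Fires-keeps (firesDown black) = refl

rule-flat : ∀ c → φ-candidate c (flat , c , true) ≡ true × rule (other c) (flat , c , true) ≡ nothing
rule-flat red = refl , refl
rule-flat black = refl , refl

rule-down : ∀ c → rule c (down , c , true) ≡ nothing × φ-candidate (other c) (down , c , true) ≡ true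
rule-down red = refl , refl
rule-down black = refl , refl

rule-unmarked : ∀ c {d c′} → rule c (d , c′ , false) ≡ nothing
rule-unmarked c {d} {c′} with rule c (d , c′ , false) in fires
... | nothing = refl
... | just _ with rule-Fires c _ fires
...   | ()

-- The position of a walk in the quarter plane counts, per class, the steps φ may still rewrite.
coordinates : List MStep → Colour → ℕ
coordinates m c = count (φ-candidate c) m

Walk : (Colour → ℕ) → List Step → Set
Walk n = QPFrom (n black) (n red)

module _ {n n′ : Colour → ℕ} {w : List Step} where

  walk-flatStep : ∀ c → n′ c ≡ suc (n c) → n′ (other c) ≡ n (other c) → Walk n′ w →
    Walk n (flatStep c ∷ w)
  walk-flatStep red more same walk = stepN (subst₂ (λ i j → QPFrom i j w) same more walk)
  walk-flatStep black more same walk = stepE (subst₂ (λ i j → QPFrom i j w) more same walk)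

  walk-markedDownStep : ∀ c → n c ≡ suc (n′ c) → n′ (other c) ≡ suc (n (other c)) → Walk n′ w →
    Walk n (markedDownStep c ∷ w)
  walk-markedDownStep red less more walk rewrite less =
    stepSE (subst (λ i → QPFrom i (n′ red) w) more walk)
  walk-markedDownStep black less more walk rewrite less =
    stepNW (subst (λ j → QPFrom (n′ black) j w) more walk)

  walk-unmarkedDownStep : ∀ c → n (other c) ≡ suc (n′ (other c)) → n′ c ≡ n c → Walk n′ w →
    Walk n (unmarkedDownStep c ∷ w)
  walk-unmarkedDownStep red less same walk rewrite less =
    stepW (subst (λ j → QPFrom (n′ black) j w) same walk)
  walk-unmarkedDownStep black less same walk rewrite less =
    stepS (subst (λ i → QPFrom i (n′ red) w) same walk)

module _ {m : List MStep} where

  private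
    fired : ∀ c {m′} → LastReplaced (rule c) m m′ →
      coordinates m c ≡ suc (coordinates m′ c) × coordinates m (other c) ≡ coordinates m′ (other c)
    fired c r = count-LastReplaced-suc _ (λ fires → Fires-removes (rule-Fires c _ fires)) r
              , count-LastReplaced-≡ _ (λ fires → Fires-keeps (rule-Fires c _ fires)) r

  phiStep-walk : ∀ {x m′ w} → PhiStep m x m′ → Walk (coordinates m′) w → Walk (coordinates m) (x ∷ w)
  phiStep-walk (appendFlat c) = walk-flatStep {coordinates m} {coordinates (m ∷ʳ _)} c
    (count-∷ʳ-accept (φ-candidate c) m (proj₁ (rule-flat c)))
    (count-∷ʳ-reject (φ-candidate (other c)) m (cong is-just (proj₂ (rule-flat c))))
  phiStep-walk (appendMarkedDown c {m″} r) = walk-markedDownStep {coordinates m} {coordinates (m″ ∷ʳ _)} c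
    (trans (proj₁ (fired c r))
           (cong suc (sym (count-∷ʳ-reject (φ-candidate c) m″ (cong is-just (proj₁ (rule-down c)))))))
    (trans (count-∷ʳ-accept (φ-candidate (other c)) m″ (proj₂ (rule-down c)))
           (cong suc (sym (proj₂ (fired c r)))))
  -- split on the colour, so that other (other c) computes
  phiStep-walk (appendUnmarkedDown red {m″} r) =
    walk-unmarkedDownStep {coordinates m} {coordinates (m″ ∷ʳ _)} red
    (trans (proj₁ (fired black r)) (cong suc (sym (count-∷ʳ-reject (φ-candidate black) m″ refl))))
    (trans (count-∷ʳ-reject (φ-candidate red) m″ refl) (sym (proj₂ (fired black r))))
  phiStep-walk (appendUnmarkedDown black {m″} r) =
    walk-unmarkedDownStep {coordinates m} {coordinates (m″ ∷ʳ _)} black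
    (trans (proj₁ (fired red r)) (cong suc (sym (count-∷ʳ-reject (φ-candidate red) m″ refl))))
    (trans (count-∷ʳ-reject (φ-candidate black) m″ refl) (sym (proj₂ (fired red r))))

phiFrom-walk : ∀ m w {m′} → phiFrom m w ≡ just m′ → Walk (coordinates m) w
phiFrom-walk m [] _ = done
phiFrom-walk m (x ∷ w) eq with phiStep x m in step
... | just m″ = phiStep-walk (phiStep-graph⁻ m x step) (phiFrom-walk m″ w eq)

φ-walk : ∀ w {m} → φ w ≡ just m → InS w
φ-walk = phiFrom-walk []

-- ψ accepts only Motzkin paths

isFree : PStep → Bool
isFree (_ , _ , status) = is-nothing status

freeSteps : List PStep → ℕ
freeSteps = count isFree

setFree-frees : ∀ p {x y} → setFree p x ≡ just y → isFree x ≡ true × isFree y ≡ false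
setFree-frees p {d , c , nothing} eq with p (d , c)
setFree-frees p {d , c , nothing} refl | true = refl , refl

unfrees : ∀ {p ps ps′} → LastReplaced (setFree p) ps ps′ → freeSteps ps ≡ suc (freeSteps ps′)
unfrees = count-LastReplaced-suc isFree (setFree-frees _)

-- The height of the input read so far is the number of free steps.
psiStep-motzkin : ∀ {ps x ps′ s} → PsiStep ps x ps′ → MotzFrom (freeSteps ps′) s →
  MotzFrom (freeSteps ps) (proj₁ x ∷ s)
psiStep-motzkin {ps} {s = s} (appendUp c) motz =
  stUp (subst (λ h → MotzFrom h s) (count-∷ʳ-accept isFree ps refl) motz)
psiStep-motzkin {s = s} (pairFlat c {ps″} r) motz =
  stFlat (subst (λ h → MotzFrom h s) (trans (count-∷ʳ-accept isFree ps″ refl) (sym (unfrees r))) motz)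
psiStep-motzkin {ps} {s = s} (markFlat c _) motz =
  stFlat (subst (λ h → MotzFrom h s) (count-∷ʳ-reject isFree ps refl) motz)
psiStep-motzkin {s = s} (pairDown c {ps″} r) motz = subst (λ h → MotzFrom h (down ∷ s)) (sym (unfrees r))
  (stDown (subst (λ h → MotzFrom h s) (count-∷ʳ-reject isFree ps″ refl) motz))
psiStep-motzkin {s = s} (markDown c {ps″} _ r) motz = subst (λ h → MotzFrom h (down ∷ s)) (sym (unfrees r))
  (stDown (subst (λ h → MotzFrom h s) (count-∷ʳ-reject isFree ps″ refl) motz))

finalize-freeSteps : ∀ ps {m} → finalize ps ≡ just m → freeSteps ps ≡ 0
finalize-freeSteps [] _ = refl
finalize-freeSteps ((d , c , just b) ∷ ps) eq with finalize ps in done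
... | just _ = finalize-freeSteps ps done

psiFrom-motzkin : ∀ s ps {ps′} → psiFrom ps s ≡ just ps′ → freeSteps ps′ ≡ 0 →
  MotzFrom (freeSteps ps) (map proj₁ s)
psiFrom-motzkin [] ps refl none = subst (λ h → MotzFrom h []) (sym none) end
psiFrom-motzkin (x ∷ s) ps eq none with psiStep x ps in step
... | just ps″ = psiStep-motzkin (psiStep-graph⁻ ps x step) (psiFrom-motzkin s ps″ eq none)

ψ-motzkin : ∀ s {m} → ψ s ≡ just m → InM2 s
ψ-motzkin s eq with psiFrom [] s in run
... | just ps = psiFrom-motzkin s [] run (finalize-freeSteps ps eq)

-- Annotated paths

data Item : Set where
  settled  : MStep → Item
  openUp   : Colour → Item
  openFlat : Colour → Item

final φ-view : Item → MStep
final (settled x) = x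
final (openUp c) = up , c , false
final (openFlat c) = flat , c , false
φ-view (settled x) = x
φ-view (openUp c) = flat , c , true
φ-view (openFlat c) = down , c , true

ψ-view : Item → PStep
ψ-view (settled (d , c , b)) = d , c , just b
ψ-view (openUp c) = up , c , nothing
ψ-view (openFlat c) = flat , c , nothing

resolve φ-resolve : Colour → Item → Maybe Item
resolve _ (settled _) = nothing
resolve red (openUp red) = just (settled (up , red , false))
resolve red (openFlat black) = just (settled (flat , black , false))
resolve black (openUp black) = just (settled (up , black , false))
resolve black (openFlat red) = just (settled (flat , red , false))
resolve _ _ = nothing
φ-resolve c (settled x) = mapMaybe settled (rule c x)
φ-resolve c a = resolve c a

ψ-view-square : ∀ c a → unmarkFree c (ψ-view a) ≡ mapMaybe ψ-view (resolve c a)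
ψ-view-square c (settled _) = refl
ψ-view-square red (openUp red) = refl
ψ-view-square red (openUp black) = refl
ψ-view-square black (openUp red) = refl
ψ-view-square black (openUp black) = refl
ψ-view-square red (openFlat red) = refl
ψ-view-square red (openFlat black) = refl
ψ-view-square black (openFlat red) = refl
ψ-view-square black (openFlat black) = refl

φ-view-square : ∀ c a → rule c (φ-view a) ≡ mapMaybe φ-view (φ-resolve c a)
φ-view-square c (settled x) with rule c x
... | just _ = refl
... | nothing = refl
φ-view-square red (openUp red) = refl
φ-view-square red (openUp black) = refl
φ-view-square black (openUp red) = refl
φ-view-square black (openUp black) = refl
φ-view-square red (openFlat red) = refl
φ-view-square red (openFlat black) = refl
φ-view-square black (openFlat red) = refl
φ-view-square black (openFlat black) = refl

φ-inert⇒inert : ∀ c a → φ-resolve c a ≡ nothing → resolve c a ≡ nothing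
φ-inert⇒inert c (settled _) _ = refl
φ-inert⇒inert c (openUp _) inert = inert
φ-inert⇒inert c (openFlat _) inert = inert

data Resolves : Colour → Item → Item → Set where
  resolveUp   : ∀ c → Resolves c (openUp c) (settled (up , c , false))
  resolveFlat : ∀ c → Resolves c (openFlat (other c)) (settled (flat , other c , false))

resolve-Resolves : ∀ c a {b} → resolve c a ≡ just b → Resolves c a b
resolve-Resolves red (openUp red) refl = resolveUp red
resolve-Resolves red (openFlat black) refl = resolveFlat red
resolve-Resolves black (openUp black) refl = resolveUp black
resolve-Resolves black (openFlat red) refl = resolveFlat black
resolve-Resolves red (openUp black) ()
resolve-Resolves red (openFlat red) ()
resolve-Resolves black (openUp red) ()
resolve-Resolves black (openFlat black) ()

Resolves-resolve : ∀ {c a b} → Resolves c a b → resolve c a ≡ just b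
Resolves-resolve (resolveUp red) = refl
Resolves-resolve (resolveUp black) = refl
Resolves-resolve (resolveFlat red) = refl
Resolves-resolve (resolveFlat black) = refl

Fires-Resolves : ∀ {c x} b → Fires c x (φ-view b) → ∃[ a ] φ-view a ≡ x × Resolves c a b
Fires-Resolves (settled _) (firesFlat c) = openUp c , refl , resolveUp c
Fires-Resolves (settled _) (firesDown c) = openFlat (other c) , refl , resolveFlat c

Resolves-final : ∀ {c a b} → Resolves c a b → final a ≡ final b
Resolves-final (resolveUp _) = refl
Resolves-final (resolveFlat _) = refl

Resolves-other : ∀ {c a b} → Resolves c a b → resolve (other c) a ≡ nothing
Resolves-other (resolveUp red) = refl
Resolves-other (resolveUp black) = refl
Resolves-other (resolveFlat red) = refl
Resolves-other (resolveFlat black) = refl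

Resolves-settled : ∀ {c a b} → Resolves c a b → ∀ c′ → resolve c′ b ≡ nothing
Resolves-settled (resolveUp _) _ = refl
Resolves-settled (resolveFlat _) _ = refl

Agrees : Colour → Item → Set
Agrees c a = φ-resolve c a ≡ resolve c a

settled-agrees : ∀ c x → rule c x ≡ nothing → Agrees c (settled x)
settled-agrees _ _ inert = cong (mapMaybe settled) inert

Resolves-agrees : ∀ {c a b} → Resolves c a b → ∀ c′ → Agrees c′ a × Agrees c′ b
Resolves-agrees (resolveUp c) c′ = refl , settled-agrees c′ (up , c , false) (rule-unmarked c′)
Resolves-agrees (resolveFlat c) c′ = refl , settled-agrees c′ (flat , other c , false) (rule-unmarked c′)

-- The search of φ also sees settled marked steps; as long as none of them lies after an open step of
-- the same class, φ and ψ select the same step.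
Consistent : Colour → List Item → Set
Consistent c [] = ⊤
Consistent c (a ∷ A) = (resolve c a ≡ nothing ⊎ All (Agrees c) A) × Consistent c A

Coherent : List Item → Set
Coherent A = ∀ c → Consistent c A

module _ {c : Colour} where

  Consistent-∷ʳ⁺ : ∀ A {a} → Consistent c A → Agrees c a ⊎ All (λ b → resolve c b ≡ nothing) A →
    Consistent c (A ∷ʳ a)
  Consistent-∷ʳ⁺ [] _ _ = inj₂ [] , tt
  Consistent-∷ʳ⁺ (b ∷ A) (inj₁ inert , cons) new =
    inj₁ inert , Consistent-∷ʳ⁺ A cons (Sum.map₂ All.tail new)
  Consistent-∷ʳ⁺ (b ∷ A) (inj₂ agree , cons) (inj₁ agreeᵃ) =
    inj₂ (∷ʳ⁺ agree agreeᵃ) , Consistent-∷ʳ⁺ A cons (inj₁ agreeᵃ)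
  Consistent-∷ʳ⁺ (b ∷ A) (inj₂ agree , cons) (inj₂ (inert ∷ inerts)) =
    inj₁ inert , Consistent-∷ʳ⁺ A cons (inj₂ inerts)

  Consistent-∷ʳ⁻ : ∀ A {a} → Consistent c (A ∷ʳ a) →
    Consistent c A × (Agrees c a ⊎ All (λ b → resolve c b ≡ nothing) A)
  Consistent-∷ʳ⁻ [] _ = tt , inj₂ []
  Consistent-∷ʳ⁻ (b ∷ A) (head , cons) with Consistent-∷ʳ⁻ A cons | head
  ... | consᴬ , inj₁ agreeᵃ | inj₁ inert = (inj₁ inert , consᴬ) , inj₁ agreeᵃ
  ... | consᴬ , inj₁ agreeᵃ | inj₂ agree = (inj₂ (proj₁ (∷ʳ⁻ agree)) , consᴬ) , inj₁ agreeᵃ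
  ... | consᴬ , inj₂ inerts | inj₁ inert = (inj₁ inert , consᴬ) , inj₂ (inert ∷ inerts)
  ... | consᴬ , inj₂ inerts | inj₂ agree = (inj₂ (proj₁ (∷ʳ⁻ agree)) , consᴬ) , inj₁ (proj₂ (∷ʳ⁻ agree))

  Consistent-resolve : ∀ {c′ A B} → LastReplaced (resolve c′) A B → Consistent c A → Consistent c B
  Consistent-resolve (here ra _) (_ , cons) = inj₁ (Resolves-settled (resolve-Resolves _ _ ra) c) , cons
  Consistent-resolve (there r) (inj₁ inert , cons) = inj₁ inert , Consistent-resolve r cons
  Consistent-resolve (there r) (inj₂ agree , cons) =
    inj₂ (LastReplaced-All⁺ (λ ra → proj₂ (Resolves-agrees (resolve-Resolves _ _ ra) c)) r agree) ,
    Consistent-resolve r cons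

  resolve⇒φ-resolve : ∀ {A B} → Consistent c A → LastReplaced (resolve c) A B →
    LastReplaced (φ-resolve c) A B
  resolve⇒φ-resolve (inj₂ agree , _) (here ra inerts) =
    here (trans (proj₁ (Resolves-agrees (resolve-Resolves _ _ ra) c)) ra)
         (All.zipWith (λ (agrees , inert) → trans agrees inert) (agree , inerts))
  resolve⇒φ-resolve (inj₁ inert , _) (here ra _) with trans (sym inert) ra
  ... | ()
  resolve⇒φ-resolve (_ , cons) (there r) = there (resolve⇒φ-resolve cons r)

Coherent-∷ʳ⁻ : ∀ B {a} → Coherent (B ∷ʳ a) → Coherent B
Coherent-∷ʳ⁻ B coh c = proj₁ (Consistent-∷ʳ⁻ B (coh c))

module _ {c : Colour} {A B : List Item} (r : LastReplaced (resolve c) A B) where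

  resolve-final : map final A ≡ map final B
  resolve-final = LastReplaced-map-≡ final (λ ra → Resolves-final (resolve-Resolves _ _ ra)) r

  resolve-ψ-view : LastReplaced (unmarkFree c) (map ψ-view A) (map ψ-view B)
  resolve-ψ-view = LastReplaced-map⁺ (ψ-view-square c) r

  resolve-φ-view : Consistent c A → LastReplaced (rule c) (map φ-view A) (map φ-view B)
  resolve-φ-view cons = LastReplaced-map⁺ (φ-view-square c) (resolve⇒φ-resolve cons r)

module _ {c : Colour} {A : List Item} where

  inert-ψ-view⁺ : All (λ a → resolve c a ≡ nothing) A → All (λ p → unmarkFree c p ≡ nothing) (map ψ-view A)
  inert-ψ-view⁺ inert =
    All.map⁺ (All.map (nothing-square⁺ {f = unmarkFree c} {resolve c} {ψ-view} (ψ-view-square c) _) inert)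

  inert-ψ-view⁻ : All (λ p → unmarkFree c p ≡ nothing) (map ψ-view A) → All (λ a → resolve c a ≡ nothing) A
  inert-ψ-view⁻ inert =
    All.map (nothing-square⁻ {f = unmarkFree c} {resolve c} {ψ-view} (ψ-view-square c) _) (All.map⁻ inert)

  ψ-view-resolve : ∀ {ps} → LastReplaced (unmarkFree c) (map ψ-view A) ps →
    ∃[ B ] LastReplaced (resolve c) A B × ps ≡ map ψ-view B
  ψ-view-resolve = LastReplaced-map⁻ (ψ-view-square c) A

-- ψ-images are φ-images

decode : MStep → Step
decode (up , c , _) = flatStep c
decode (flat , c , true) = flatStep c
decode (flat , c , false) = markedDownStep c
decode (down , c , true) = markedDownStep c
decode (down , c , false) = unmarkedDownStep c

record ForwardStep (A : List Item) (ps : List PStep) : Set where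
  constructor forward
  field
    next     : List Item
    new      : Item
    ψ-state  : ps ≡ map ψ-view next
    finals   : map final next ≡ map final A ∷ʳ final new
    coherent : Coherent next
    φ-step   : PhiStep (map φ-view A) (decode (final new)) (map φ-view next)

forwardStep : ∀ {A ps} B new → map final B ≡ map final A → Coherent (B ∷ʳ new) →
  ps ≡ map ψ-view B ∷ʳ ψ-view new →
  PhiStep (map φ-view A) (decode (final new)) (map φ-view B ∷ʳ φ-view new) →
  ForwardStep A ps
forwardStep B new finals coherent ψ-state φ-step = record
  { next = B ∷ʳ new
  ; new = new
  ; ψ-state = trans ψ-state (sym (map-++ ψ-view B [ new ]))
  ; finals = trans (map-++ final B [ new ]) (cong (_∷ʳ final new) finals)
  ; coherent = coherent
  ; φ-step = subst (PhiStep _ _) (sym (map-++ φ-view B [ new ])) φ-step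
  }

psiStep-forward : ∀ A {x ps} → Coherent A → PsiStep (map ψ-view A) x ps → ForwardStep A ps
psiStep-forward A coh (appendUp c) =
  forwardStep A (openUp c) refl (λ c′ → Consistent-∷ʳ⁺ A (coh c′) (inj₁ refl)) refl (appendFlat c)
psiStep-forward A coh (pairFlat c r) with ψ-view-resolve r
... | B , r′ , refl =
  forwardStep B (openFlat c) (sym (resolve-final r′))
    (λ c′ → Consistent-∷ʳ⁺ B (Consistent-resolve r′ (coh c′)) (inj₁ refl)) refl
    (appendMarkedDown c (resolve-φ-view r′ (coh c)))
psiStep-forward A coh (markFlat c unpaired) =
  forwardStep A (settled (flat , c , true)) refl
    (onBoth c (Consistent-∷ʳ⁺ A (coh c) (inj₂ (inert-ψ-view⁻ unpaired)))
              (Consistent-∷ʳ⁺ A (coh (other c)) (inj₁ (settled-agrees (other c) _ (proj₂ (rule-flat c))))))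
    refl (appendFlat c)
psiStep-forward A coh (pairDown c r) with ψ-view-resolve r
... | B , r′ , refl =
  forwardStep B (settled (down , c , false)) (sym (resolve-final r′))
    (λ c′ → Consistent-∷ʳ⁺ B (Consistent-resolve r′ (coh c′)) (inj₁ (settled-agrees c′ _ (rule-unmarked c′))))
    refl
    (appendUnmarkedDown c (resolve-φ-view r′ (coh (other c))))
psiStep-forward A coh (markDown c unpaired r) with ψ-view-resolve r
... | B , r′ , refl =
  forwardStep B (settled (down , c , true)) (sym (resolve-final r′))
    (onBoth c (Consistent-∷ʳ⁺ B (Consistent-resolve r′ (coh c))
                (inj₁ (settled-agrees c _ (proj₁ (rule-down c)))))
              (Consistent-∷ʳ⁺ B (Consistent-resolve r′ (coh (other c)))
                (inj₂ (LastReplaced-All⁺ (λ ra → Resolves-settled (resolve-Resolves _ _ ra) (other c)) r′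
                        (inert-ψ-view⁻ unpaired)))))
    refl (appendMarkedDown c (resolve-φ-view r′ (coh c)))

finalize-ψ-view : ∀ A {m} → finalize (map ψ-view A) ≡ just m → map final A ≡ m × map φ-view A ≡ m
finalize-ψ-view [] refl = refl , refl
finalize-ψ-view (settled (d , c , b) ∷ A) eq with finalize (map ψ-view A) in done
finalize-ψ-view (settled (d , c , b) ∷ A) refl | just _ with finalize-ψ-view A done
... | refl , φ-view-A = refl , cong ((d , c , b) ∷_) φ-view-A

phiFrom-∷ : ∀ {x m m′} w → phiStep x m ≡ just m′ → phiFrom m (x ∷ w) ≡ phiFrom m′ w
phiFrom-∷ w step rewrite step = refl

psiFrom-forward : ∀ s A {ps m} → Coherent A → psiFrom (map ψ-view A) s ≡ just ps → finalize ps ≡ just m →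
  ∃[ rest ] m ≡ map final A ++ rest × phiFrom (map φ-view A) (map decode rest) ≡ just m
psiFrom-forward [] A coh refl fin with finalize-ψ-view A fin
... | refl , φ-view-A = [] , sym (++-identityʳ _) , cong just φ-view-A
psiFrom-forward (x ∷ s) A coh run fin with psiStep x (map ψ-view A) in step
... | just _ with psiStep-forward A coh (psiStep-graph⁻ _ x step)
...   | forward next new refl finals coherent φ-step with psiFrom-forward s next coherent run fin
...     | rest , split , φ-run =
  final new ∷ rest ,
  trans split (trans (cong (_++ rest) finals) (∷ʳ-++ (map final A) _ rest)) ,
  trans (phiFrom-∷ {decode (final new)} {map φ-view A} (map decode rest) (phiStep-graph⁺ φ-step)) φ-run

ψ-image⇒φ-image : ∀ s {m} → ψ s ≡ just m → φ (map decode m) ≡ just m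
ψ-image⇒φ-image s eq with psiFrom [] s in run
... | just _ with psiFrom-forward s [] (λ _ → tt) run eq
...   | _ , refl , φ-run = φ-run

-- φ-images are ψ-images

record Unresolved (c : Colour) (m : List MStep) (B : List Item) : Set where
  constructor unresolved
  field
    items      : List Item
    φ-state    : map φ-view items ≡ m
    resolution : LastReplaced (resolve c) items B
    coherent   : Coherent B → Coherent items

unresolve : ∀ c {m} B → LastReplaced (rule c) m (map φ-view B) → Unresolved c m B
unresolve c (b ∷ B) (here {x} fires inert) with Fires-Resolves b (rule-Fires c x fires)
... | a , refl , res = unresolved (a ∷ B) refl (here (Resolves-resolve res) inertᴮ)
  (λ coh c′ → onBoth c (inj₂ agreeᴮ) (inj₁ (Resolves-other res)) c′ , proj₂ (coh c′))
  where
  φ-inertᴮ : All (λ b → φ-resolve c b ≡ nothing) B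
  φ-inertᴮ =
    All.map (λ {b} → nothing-square⁻ {f = rule c} {φ-resolve c} {φ-view} (φ-view-square c) b) (All.map⁻ inert)
  inertᴮ : All (λ b → resolve c b ≡ nothing) B
  inertᴮ = All.map (λ {b} → φ-inert⇒inert c b) φ-inertᴮ
  agreeᴮ : All (Agrees c) B
  agreeᴮ = All.zipWith (λ (φ-inert , inert) → trans φ-inert (sym inert)) (φ-inertᴮ , inertᴮ)
unresolve c (b ∷ B) (there r) with unresolve c B r
... | unresolved A φ-A r′ coherent =
  unresolved (b ∷ A) (cong (φ-view b ∷_) φ-A) (there r′)
    (λ coh c′ → Sum.map₂ (LastReplaced-All⁻ (λ ra → proj₁ (Resolves-agrees (resolve-Resolves _ _ ra) c′)) r′)
                         (proj₁ (coh c′))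
              , coherent (λ c″ → proj₂ (coh c″)) c′)

forget : MStep → CStep
forget = map₂ proj₁

φ-view-flat : ∀ a {c} → φ-view a ≡ (flat , c , true) → a ≡ settled (flat , c , true) ⊎ a ≡ openUp c
φ-view-flat (settled _) refl = inj₁ refl
φ-view-flat (openUp _) refl = inj₂ refl

φ-view-down : ∀ a {c} → φ-view a ≡ (down , c , true) → a ≡ settled (down , c , true) ⊎ a ≡ openFlat c
φ-view-down (settled _) refl = inj₁ refl
φ-view-down (openFlat _) refl = inj₂ refl

φ-view-unmarked : ∀ a {d c} → φ-view a ≡ (d , c , false) → a ≡ settled (d , c , false)
φ-view-unmarked (settled _) refl = refl

inert-before-candidate : ∀ c B x → φ-candidate c x ≡ true → Consistent c (B ∷ʳ settled x) →
  All (λ b → resolve c b ≡ nothing) B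
inert-before-candidate c B x candidate cons with Consistent-∷ʳ⁻ B cons
... | _ , inj₂ inert = inert
... | _ , inj₁ agrees = ⊥-elim (disagrees (rule c x) candidate agrees)
  where
  disagrees : ∀ y → is-just y ≡ true → mapMaybe settled y ≢ nothing
  disagrees (just _) _ ()

record BackwardStep (m : List MStep) (A′ : List Item) : Set where
  constructor backward
  field
    items    : List Item
    new      : Item
    φ-state  : map φ-view items ≡ m
    finals   : map final A′ ≡ map final items ∷ʳ final new
    coherent : Coherent items
    ψ-step   : PsiStep (map ψ-view items) (forget (final new)) (map ψ-view A′)

backwardStep : ∀ {m} A B new → map φ-view A ≡ m → map final A ≡ map final B → Coherent A →
  PsiStep (map ψ-view A) (forget (final new)) (map ψ-view B ∷ʳ ψ-view new) → BackwardStep m (B ∷ʳ new)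
backwardStep A B new φ-state finals coherent ψ-step = record
  { items = A
  ; new = new
  ; φ-state = φ-state
  ; finals = trans (map-++ final B [ new ]) (cong (_∷ʳ final new) (sym finals))
  ; coherent = coherent
  ; ψ-step = subst (PsiStep _ _) (sym (map-++ ψ-view B [ new ])) ψ-step
  }

phiStep-backward : ∀ {m x m′} A′ → PhiStep m x m′ → map φ-view A′ ≡ m′ → Coherent A′ → BackwardStep m A′
phiStep-backward A′ (appendFlat c) φ-A′ coh with map-∷ʳ⁻ φ-view A′ φ-A′
... | B , a , refl , φ-B , φ-a with φ-view-flat a φ-a
...   | inj₁ refl = backwardStep B B a φ-B refl (Coherent-∷ʳ⁻ B coh)
          (markFlat c (inert-ψ-view⁺ (inert-before-candidate c B _ (proj₁ (rule-flat c)) (coh c))))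
...   | inj₂ refl = backwardStep B B a φ-B refl (Coherent-∷ʳ⁻ B coh) (appendUp c)
phiStep-backward A′ (appendMarkedDown c r) φ-A′ coh with map-∷ʳ⁻ φ-view A′ φ-A′
... | B , a , refl , refl , φ-a with unresolve c B r
...   | unresolved A φ-A r′ coherent with φ-view-down a φ-a
...     | inj₁ refl = backwardStep A B a φ-A (resolve-final r′) (coherent (Coherent-∷ʳ⁻ B coh))
          (markDown c
            (inert-ψ-view⁺ (LastReplaced-All⁻ (λ ra → Resolves-other (resolve-Resolves _ _ ra)) r′
              (inert-before-candidate (other c) B _ (proj₂ (rule-down c)) (coh (other c)))))
            (resolve-ψ-view r′))
...     | inj₂ refl = backwardStep A B a φ-A (resolve-final r′) (coherent (Coherent-∷ʳ⁻ B coh))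
          (pairFlat c (resolve-ψ-view r′))
phiStep-backward A′ (appendUnmarkedDown c r) φ-A′ coh with map-∷ʳ⁻ φ-view A′ φ-A′
... | B , a , refl , refl , φ-a with unresolve (other c) B r | φ-view-unmarked a φ-a
...   | unresolved A φ-A r′ coherent | refl =
  backwardStep A B a φ-A (resolve-final r′) (coherent (Coherent-∷ʳ⁻ B coh)) (pairDown c (resolve-ψ-view r′))

record Annotation (m mf : List MStep) : Set where
  constructor annotation
  field
    items    : List Item
    rest     : List MStep
    split    : mf ≡ map final items ++ rest
    φ-state  : map φ-view items ≡ m
    coherent : Coherent items
    ψ-run    : psiFrom (map ψ-view items) (map forget rest) ≡ just (map ψ-view (map settled mf))

settled-coherent : ∀ m → Coherent (map settled m)
settled-coherent [] _ = tt
settled-coherent (x ∷ m) c = inj₁ refl , settled-coherent m c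

psiFrom-∷ : ∀ {x ps ps′} s → psiStep x ps ≡ just ps′ → psiFrom ps (x ∷ s) ≡ psiFrom ps′ s
psiFrom-∷ s step rewrite step = refl

phiFrom-backward : ∀ w m {mf} → phiFrom m w ≡ just mf → Annotation m mf
phiFrom-backward [] m refl =
  annotation (map settled m) [] (sym (trans (++-identityʳ _) (final-settled))) φ-view-settled
    (settled-coherent m) refl
  where
  final-settled : map final (map settled m) ≡ m
  final-settled = trans (sym (map-∘ m)) (map-id m)
  φ-view-settled : map φ-view (map settled m) ≡ m
  φ-view-settled = trans (sym (map-∘ m)) (map-id m)
phiFrom-backward (x ∷ w) m run with phiStep x m in step
... | just _ with phiFrom-backward w _ run
...   | annotation A′ rest split φ-A′ coh ψ-run
  with phiStep-backward A′ (phiStep-graph⁻ m x step) φ-A′ coh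
...     | backward A new φ-A finals coherent ψ-step =
  annotation A (final new ∷ rest) (trans split (trans (cong (_++ rest) finals) (∷ʳ-++ (map final A) _ rest)))
    φ-A coherent
    (trans (psiFrom-∷ {forget (final new)} {map ψ-view A} (map forget rest) (psiStep-graph⁺ ψ-step)) ψ-run)

finalize-settled : ∀ m → finalize (map ψ-view (map settled m)) ≡ just m
finalize-settled [] = refl
finalize-settled (x ∷ m) rewrite finalize-settled m = refl

φ-image⇒ψ-image : ∀ w {m} → φ w ≡ just m → ψ (map forget m) ≡ just m
φ-image⇒ψ-image w {m} run with phiFrom-backward w [] run
... | annotation [] rest refl refl _ ψ-run rewrite ψ-run = finalize-settled m

mainTheorem7 : (m : List MStep) →
    (∃[ w ] (InS w × φ w ≡ just m)) ⇔ (∃[ s ] (InM2 s × ψ s ≡ just m))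
mainTheorem7 m = mk⇔
  (λ (w , _ , φ-w) → let ψ-m = φ-image⇒ψ-image w φ-w in map forget m , ψ-motzkin _ ψ-m , ψ-m)
  (λ (s , _ , ψ-s) → let φ-m = ψ-image⇒φ-image s ψ-s in map decode m , φ-walk _ φ-m , φ-m)
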